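{- Let $(L,U,\leq)$ be an approximation tuple. Then $\langle L\otimes U,\leq_p\rangle$ is a chain-complete poset, i.e. every chain in it has a least upper bound.
   Context: An approximation tuple is a tuple $(L,U,\leq)$ where $L,U$ are sets and $\leq$ is a partial order on $L\cup U$ such that: $\langle L\cup U,\leq\rangle$ has a top element $\top$ and bottom element $\bot$; $\top,\bot\in L\cap U$; $\langle L,\leq\rangle$ and $\langle U,\leq\rangle$ are complete lattices; (ILP) for all $b\in U$ and all $S\subseteq L$ with $x\leq b$ for every $x\in S$, the least upper bound of $S$ in $L$ is $\leq b$; (IGP) for all $a\in L$ and all $S\subseteq U$ with $a\leq x$ for every $x\in S$, $a$ is $\leq$ the greatest lower bound of $S$ in $U$. $L\otimes U=\{(x,y)\mid x\in L, y\in U, x\leq y\}$ with the precision order $(x_1,y_1)\leq_p(x_2,y_2)$ iff $x_1\leq x_2$ and $y_2\leq y_1$. -}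

module Defs where

open import Level using (0ℓ)
open import Data.Product using (Σ; ∃; _×_; _,_)
open import Data.Sum using (_⊎_)
open import Relation.Unary using (Pred; _⊆_)
open import Relation.Binary.PropositionalEquality using (_≡_)
open import Relation.Binary.Structures using (IsPartialOrder)

module _ {A : Set} (_≤_ : A → A → Set) where

  IsUpperBound : Pred A 0ℓ → A → Set
  IsUpperBound S a = ∀ x → S x → x ≤ a

  IsLowerBound : Pred A 0ℓ → A → Set
  IsLowerBound S a = ∀ x → S x → a ≤ x

  IsLubIn : Pred A 0ℓ → Pred A 0ℓ → A → Set
  IsLubIn P S a = P a × IsUpperBound S a × (∀ b → P b → IsUpperBound S b → a ≤ b)

  IsGlbIn : Pred A 0ℓ → Pred A 0ℓ → A → Set
  IsGlbIn P S a = P a × IsLowerBound S a × (∀ b → P b → IsLowerBound S b → b ≤ a)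

  IsCompleteLatticeOn : Pred A 0ℓ → Set₁
  IsCompleteLatticeOn P =
    (S : Pred A 0ℓ) → S ⊆ P → (∃ λ a → IsLubIn P S a) × (∃ λ a → IsGlbIn P S a)

-- An approximation tuple (L, U, ≤).  The carrier A plays the role of L ∪ U;
-- L and U are subsets of A (predicates) whose union is all of A.
record ApproxTuple : Set₁ where
  field
    A    : Set
    L    : Pred A 0ℓ
    U    : Pred A 0ℓ
    _≤_  : A → A → Set
    cover : ∀ a → L a ⊎ U a
    isPartialOrder : IsPartialOrder _≡_ _≤_
    ⊤ : A
    ⊥ : A
    ⊤-max : ∀ a → a ≤ ⊤
    ⊥-min : ∀ a → ⊥ ≤ a
    L⊤ : L ⊤
    U⊤ : U ⊤
    L⊥ : L ⊥
    U⊥ : U ⊥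
    L-complete : IsCompleteLatticeOn _≤_ L
    U-complete : IsCompleteLatticeOn _≤_ U
    ILP : ∀ b → U b → (S : Pred A 0ℓ) → S ⊆ L → IsUpperBound _≤_ S b →
          ∀ a → IsLubIn _≤_ L S a → a ≤ b
    IGP : ∀ a → L a → (S : Pred A 0ℓ) → S ⊆ U → IsLowerBound _≤_ S a →
          ∀ c → IsGlbIn _≤_ U S c → a ≤ c

module _ (T : ApproxTuple) where
  open ApproxTuple T

  record LU : Set where
    constructor ⟨_,_,_,_,_⟩
    field
      lo    : A
      hi    : A
      lo∈L  : L lo
      hi∈U  : U hi
      lo≤hi : lo ≤ hi

  open LU public

  _≤p_ : LU → LU → Set
  p ≤p q = (lo p ≤ lo q) × (hi q ≤ hi p)

  _≈p_ : LU → LU → Set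
  p ≈p q = (lo p ≡ lo q) × (hi p ≡ hi q)

  IsChain : Pred LU 0ℓ → Set
  IsChain C = ∀ p q → C p → C q → (p ≤p q) ⊎ (q ≤p p)

  IsLubP : Pred LU 0ℓ → LU → Set
  IsLubP C p = (∀ q → C q → q ≤p p) × (∀ r → (∀ q → C q → q ≤p r) → p ≤p r)

  IsChainCompletePoset : Set₁
  IsChainCompletePoset =
    IsPartialOrder _≈p_ _≤p_ × ((C : Pred LU 0ℓ) → IsChain C → ∃ λ p → IsLubP C p)

-- For a chain C in L ⊗ U take a = ⋁ {lo q | q ∈ C} in L and b = ⋀ {hi q | q ∈ C} in U.
-- Comparability of any two elements of C makes every hi q an upper bound of the lo's,
-- so a ≤ hi q by (ILP); then a is a lower bound of the hi's, so a ≤ b by (IGP).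
-- Hence (a, b) ∈ L ⊗ U, and it is the precision-lub of C componentwise.
module Submission where

open import Defs
open import Level using (0ℓ)
open import Data.Product using (∃; _×_; _,_; proj₁; proj₂)
open import Data.Sum using (inj₁; inj₂)
open import Relation.Unary using (Pred)
open import Relation.Binary.PropositionalEquality using (_≡_; refl; sym; trans)
open import Relation.Binary.Structures using (IsPartialOrder)

module _ (T : ApproxTuple) where
  open ApproxTuple T
  open IsPartialOrder isPartialOrder using ()
    renaming (refl to ≤-refl; trans to ≤-trans; antisym to ≤-antisym)

  ≤p-isPartialOrder : IsPartialOrder (_≈p_ T) (_≤p_ T)
  ≤p-isPartialOrder = record
    { isPreorder = record
      { isEquivalence = record
        { refl  = refl , refl
        ; sym   = λ (l , h) → sym l , sym h
        ; trans = λ (l , h) (l′ , h′) → trans l l′ , trans h h′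
        }
      ; reflexive = λ { (refl , refl) → ≤-refl , ≤-refl }
      ; trans     = λ (l , h) (l′ , h′) → ≤-trans l l′ , ≤-trans h′ h
      }
    ; antisym = λ (l , h) (l′ , h′) → ≤-antisym l l′ , ≤-antisym h′ h
    }

  los : Pred (LU T) 0ℓ → Pred A 0ℓ
  los C x = ∃ λ q → C q × lo q ≡ x

  his : Pred (LU T) 0ℓ → Pred A 0ℓ
  his C y = ∃ λ q → C q × hi q ≡ y

  los⊆L : ∀ C {x} → los C x → L x
  los⊆L C (q , _ , refl) = lo∈L q

  his⊆U : ∀ C {y} → his C y → U y
  his⊆U C (q , _ , refl) = hi∈U q

  module _ {C : Pred (LU T) 0ℓ} where

    hi-isUpperBound-los : IsChain T C → ∀ {q} → C q → IsUpperBound _≤_ (los C) (hi q)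
    hi-isUpperBound-los chain {q} Cq _ (p , Cp , refl) with chain p q Cp Cq
    ... | inj₁ (lo-p≤lo-q , _) = ≤-trans lo-p≤lo-q (lo≤hi q)
    ... | inj₂ (_ , hi-q≤hi-p) = ≤-trans (lo≤hi p) hi-q≤hi-p

    lub-los≤glb-his : IsChain T C → ∀ {a b} →
                      IsLubIn _≤_ L (los C) a → IsGlbIn _≤_ U (his C) b → a ≤ b
    lub-los≤glb-his chain {a} {b} a-lub b-glb =
      IGP a (proj₁ a-lub) (his C) (his⊆U C) a-isLowerBound-his b b-glb
      where
      a-isLowerBound-his : IsLowerBound _≤_ (his C) a
      a-isLowerBound-his _ (q , Cq , refl) =
        ILP (hi q) (hi∈U q) (los C) (los⊆L C) (hi-isUpperBound-los chain Cq) a a-lub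

    componentwise-isLubP : ∀ {a b} (a-lub : IsLubIn _≤_ L (los C) a)
                           (b-glb : IsGlbIn _≤_ U (his C) b) (a≤b : a ≤ b) →
                           IsLubP T C ⟨ a , b , proj₁ a-lub , proj₁ b-glb , a≤b ⟩
    componentwise-isLubP (_ , a-ub , a-least) (_ , b-lb , b-greatest) _ =
        (λ q Cq → a-ub (lo q) (q , Cq , refl) , b-lb (hi q) (q , Cq , refl))
      , (λ r r-ub → a-least (lo r) (lo∈L r) (λ { _ (q , Cq , refl) → proj₁ (r-ub q Cq) })
                  , b-greatest (hi r) (hi∈U r) (λ { _ (q , Cq , refl) → proj₂ (r-ub q Cq) }))

  chain-hasLubP : (C : Pred (LU T) 0ℓ) → IsChain T C → ∃ λ p → IsLubP T C p
  chain-hasLubP C chain with L-complete (los C) (los⊆L C) | U-complete (his C) (his⊆U C)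
  ... | (a , a-lub) , _ | _ , (b , b-glb) =
    ⟨ a , b , proj₁ a-lub , proj₁ b-glb , a≤b ⟩ , componentwise-isLubP a-lub b-glb a≤b
    where
    a≤b : a ≤ b
    a≤b = lub-los≤glb-his chain a-lub b-glb

proposition6 : (T : ApproxTuple) → IsChainCompletePoset T
proposition6 T = ≤p-isPartialOrder T , chain-hasLubP T
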